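{- Consider the Kadanoff sand pile model KSPM(3), i.e. with parameter $D=3$. There exists a function $N\mapsto i(N)$ with $i(N)=O(\log N)$ such that for every $N$ the tail $\pi(N)_{[i(N),\infty[}=(\pi(N)_{i(N)},\pi(N)_{i(N)+1},\dots)$ belongs to $(2,1)^*[0](2,1)^*0^\omega$. Equivalently, there are integers $m,m'\ge 0$ and $e\in\{0,1\}$ such that this tail equals $(2,1)^m$, followed by $e$ copies of $0$, followed by $(2,1)^{m'}$, followed by zeros forever.
   Context: KSPM($D$), for an integer parameter $D\ge 2$, is defined as follows. A configuration is an ultimately null sequence $\sigma=(\sigma_0,\sigma_1,\dots)$ of nonnegative integers. Here $\sigma_i=h_i-h_{i+1}$ is the height difference between columns $i$ and $i+1$ of a sand pile. There is a transition $\sigma\to\sigma'$ on column $i$ when $\sigma_i\ge D$ and: - $\sigma'_{i-1}=\sigma_{i-1}+D-1$ (if $i\ne 0$), - $\sigma'_i=\sigma_i-D$, - $\sigma'_{i+D-1}=\sigma_{i+D-1}+1$, - $\sigma'_j=\sigma_j$ for all other $j$. A configuration is stable (a fixed point) if no transition applies. From every configuration $\sigma$, every maximal sequence of transitions ends in the same stable configuration $\pi(\sigma)$. We write $\pi(N)=\pi((N,0,0,\dots))$, the fixed point reached from $N$ grains stacked on column $0$. Notation: $0^\omega$ denotes the infinite sequence of zeros, $(2,1)^*$ denotes any finite number of repetitions of the block $2,1$, and $[0]$ denotes at most one $0$. -}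

module Defs where

open import Data.Nat using (ℕ; zero; suc; _+_; _*_; _∸_; _≤_; _<_; _≡ᵇ_)
open import Data.Bool using (if_then_else_)
open import Data.List using (List; []; _∷_; _++_; replicate; concat)
open import Relation.Binary.Construct.Closure.ReflexiveTransitive using (Star)

-- A configuration: σ i = h_i − h_{i+1}.  Configurations reachable from
-- (N,0,0,…) are automatically ultimately null.
Config : Set
Config = ℕ → ℕ

init : ℕ → Config
init N zero    = N
init N (suc _) = 0

-- Firing column i in KSPM(D): column i−1 gains D−1 (only if i ≠ 0, which is
-- automatic since j+1 ≡ i forces i ≥ 1), column i loses D, column i+D−1 gains 1.
topple : ℕ → ℕ → Config → Config
topple D i σ j =
  ((σ j + (if suc j ≡ᵇ i then D ∸ 1 else 0))
     ∸ (if j ≡ᵇ i then D else 0))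
     + (if j ≡ᵇ (i + (D ∸ 1)) then 1 else 0)

data Step (D : ℕ) : Config → Config → Set where
  fire : (σ : Config) (i : ℕ) → D ≤ σ i → Step D σ (topple D i σ)

Reach : ℕ → Config → Config → Set
Reach D = Star (Step D)

Stable : ℕ → Config → Set
Stable D σ = (i : ℕ) → σ i < D

listSeq : List ℕ → ℕ → ℕ
listSeq []       _       = 0
listSeq (x ∷ xs) zero    = x
listSeq (x ∷ xs) (suc k) = listSeq xs k

pattern21 : ℕ → ℕ → ℕ → List ℕ
pattern21 m e m' =
  concat (replicate m (2 ∷ 1 ∷ [])) ++ replicate e 0 ++ concat (replicate m' (2 ∷ 1 ∷ []))

module Submission where

-- Let c be the odometer of a run (c_j = number of firings of column j).  A
-- run from σ₀ to σ keeps σ_j + D c_j = σ₀_j + (D−1) c_{j+1} + c_{j−D+1}, and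
-- by least action the odometer of a stable configuration reachable from σ₀
-- is the least "stabilizing" function; so stable configurations are unique
-- (module LeastAction, for every D ≥ 2 and every σ₀).  For D = 3 and
-- σ₀ = (N, 0, …) the wedge N ∸ j is stabilizing; it bounds every run, which
-- yields the stable configuration π(N) (module Stabilisation).
-- For the final odometer the second difference e_j = 2c_j − c_{j+1} − c_{j−1}
-- obeys 2e_{j+1} + e_j + π(N)_{j+1} = 0, so |e| decays to ≤ 2 after
-- L = ⌊log₂ N⌋ + 3 columns and e ∈ {−1, 0} three columns later.  There
-- π(N)_{j+1} = 2 kink_{j+1} + kink_j with isolated kinks kink_j = −e_j, so the
-- tail is a word in the blocks 2 1 and 0; two 0s with a 2 after the second
-- are excluded by least action, since the odometer could be lowered by one
-- on the block between them (module NoLowerableBlock, used in StableShape).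
-- The theorem reads the tail from column ⌊log₂ N⌋ + 8, one further when π(N)
-- is odd there.

open import Defs
open import Data.Nat
open import Data.Nat.Properties
open import Data.Nat.DivMod using (_%_; m%n<n; m<n⇒m%n≡m; [m+kn]%n≡m%n)
open import Data.Nat.Logarithm using (⌊log₂_⌋; ⌊log₂⌋-mono-≤; ⌊log₂[2^n]⌋≡n)
open import Data.Nat.Tactic.RingSolver using (solve-∀)
open import Data.Integer as ℤ using (ℤ; +_; -[1+_]; ∣_∣; 0ℤ)
import Data.Integer.Properties as ℤ
import Data.Integer.Tactic.RingSolver as ℤ-Ring
open import Data.Bool using (Bool; true; false; T; if_then_else_)
open import Data.Product using (Σ; _×_; _,_; proj₁; proj₂)
open import Data.Sum using (_⊎_; inj₁; inj₂)
open import Data.Empty using (⊥; ⊥-elim)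
open import Data.List using (List; []; _∷_; _++_; length; concat; replicate)
open import Data.Fin using (Fin; toℕ; fromℕ<)
open import Data.Fin.Properties using (all?; ¬∀⟶∃¬; toℕ-fromℕ<)
open import Function using (_∘_)
open import Relation.Nullary using (¬_; Dec; yes; no)
open import Relation.Binary.PropositionalEquality
open import Relation.Binary.Construct.Closure.ReflexiveTransitive using (ε; _◅_)

𝟙 : Bool → ℕ
𝟙 b = if b then 1 else 0

≡ᵇ-true : ∀ {m n} → (m ≡ᵇ n) ≡ true → m ≡ n
≡ᵇ-true {m} {n} eq = ≡ᵇ⇒≡ m n (subst T (sym eq) _)

≡ᵇ-false : ∀ {m n} → m ≢ n → (m ≡ᵇ n) ≡ false
≡ᵇ-false {m} {n} m≢n with m ≡ᵇ n in eq
... | true  = ⊥-elim (m≢n (≡ᵇ-true eq))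
... | false = refl

≡ᵇ-refl : ∀ n → (n ≡ᵇ n) ≡ true
≡ᵇ-refl zero    = refl
≡ᵇ-refl (suc n) = ≡ᵇ-refl n

shift : ℕ → (ℕ → ℕ) → ℕ → ℕ
shift zero    c j       = c j
shift (suc k) c zero    = 0
shift (suc k) c (suc j) = shift k c j

addShot : (ℕ → ℕ) → ℕ → ℕ → ℕ
addShot c i j = c j + 𝟙 (j ≡ᵇ i)

addShot-at : ∀ c i → addShot c i i ≡ suc (c i)
addShot-at c i = trans (cong (λ b → c i + 𝟙 b) (≡ᵇ-refl i)) (+-comm (c i) 1)

shift-addShot : ∀ k c i j → shift k (addShot c i) j ≡ shift k c j + 𝟙 (j ≡ᵇ i + k)
shift-addShot zero    c i j       rewrite +-identityʳ i = refl
shift-addShot (suc k) c i zero    rewrite +-suc i k = refl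
shift-addShot (suc k) c i (suc j) rewrite +-suc i k = shift-addShot k c i j

-- Bookkeeping of one firing at the level of the three indicators involved:
-- b₁ = [j is the fired column], b₂ = [j is its left neighbour],
-- b₃ = [j receives the grain sent D − 1 columns to the right].
firing-arith : ∀ D s b₁ b₂ b₃ →
  (b₁ ≡ true → D ≤ s × b₂ ≡ false × b₃ ≡ false) → (b₂ ≡ true → b₃ ≡ false) →
  ((s + (if b₂ then D ∸ 1 else 0)) ∸ (if b₁ then D else 0)) + 𝟙 b₃ + D * 𝟙 b₁
    ≡ s + (D ∸ 1) * 𝟙 b₂ + 𝟙 b₃
firing-arith D s true b₂ b₃ fired _ with fired refl
... | D≤s , refl , refl = begin
  (s + 0 ∸ D) + 0 + D * 1 ≡⟨ cong₂ (λ x y → (x ∸ D) + 0 + y) (+-identityʳ s) (*-identityʳ D) ⟩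
  (s ∸ D) + 0 + D         ≡⟨ cong (_+ D) (+-identityʳ (s ∸ D)) ⟩
  (s ∸ D) + D             ≡⟨ m∸n+n≡m D≤s ⟩
  s                       ≡⟨ pad s (D ∸ 1) ⟩
  s + (D ∸ 1) * 0 + 0     ∎
  where
  open ≡-Reasoning
  pad : ∀ x y → x ≡ x + y * 0 + 0
  pad = solve-∀
firing-arith D s false true b₃ _ left with left refl
... | refl = arith s (D ∸ 1) D
  where
  arith : ∀ x y z → x + y + 0 + z * 0 ≡ x + y * 1 + 0
  arith = solve-∀
firing-arith D s false false b₃ _ _ = arith s (D ∸ 1) D (𝟙 b₃)
  where
  arith : ∀ x y z t → x + 0 + t + z * 0 ≡ x + y * 0 + t
  arith = solve-∀

-- The effect of firing column i, written without truncated subtraction.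
topple-balance : ∀ D → 2 ≤ D → ∀ σ i → D ≤ σ i → ∀ j →
  topple D i σ j + D * 𝟙 (j ≡ᵇ i) ≡ σ j + (D ∸ 1) * 𝟙 (suc j ≡ᵇ i) + 𝟙 (j ≡ᵇ i + (D ∸ 1))
topple-balance D@(suc (suc d)) (s≤s (s≤s z≤n)) σ i D≤σi j =
  firing-arith D (σ j) (j ≡ᵇ i) (suc j ≡ᵇ i) (j ≡ᵇ i + suc d) at-fired at-left-neighbour
  where
  at-fired : (j ≡ᵇ i) ≡ true → D ≤ σ j × (suc j ≡ᵇ i) ≡ false × (j ≡ᵇ i + suc d) ≡ false
  at-fired j≡ᵇi with refl ← ≡ᵇ-true {j} {i} j≡ᵇi =
    D≤σi , ≡ᵇ-false (1+n≢n {j}) , ≡ᵇ-false (m+1+n≢m i ∘ sym)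
  at-left-neighbour : (suc j ≡ᵇ i) ≡ true → (j ≡ᵇ i + suc d) ≡ false
  at-left-neighbour sj≡ᵇi with refl ← ≡ᵇ-true {suc j} {i} sj≡ᵇi = ≡ᵇ-false (m≢1+m+n j)

-- c counts how often each column fired on the way from σ₀ to σ.
Odometer : ℕ → Config → Config → (ℕ → ℕ) → Set
Odometer D σ₀ σ c = ∀ j → σ j + D * c j ≡ σ₀ j + (D ∸ 1) * c (suc j) + shift (D ∸ 1) c j

-- Firing g from σ₀ would leave every column with height difference < D
-- (were g realisable); the final odometer is the least such g.
Stabilizing : ℕ → Config → (ℕ → ℕ) → Set
Stabilizing D σ₀ g = ∀ j → σ₀ j + (D ∸ 1) * g (suc j) + shift (D ∸ 1) g j ≤ (D ∸ 1) + D * g j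

_≼_ : (ℕ → ℕ) → (ℕ → ℕ) → Set
c ≼ g = ∀ j → c j ≤ g j

shift-mono : ∀ k {c g} → c ≼ g → shift k c ≼ shift k g
shift-mono zero    c≼g j       = c≼g j
shift-mono (suc k) c≼g zero    = z≤n
shift-mono (suc k) c≼g (suc j) = shift-mono k c≼g j

shift-cong : ∀ k {c g} → (∀ j → c j ≡ g j) → ∀ j → shift k c j ≡ shift k g j
shift-cong zero    c≗g j       = c≗g j
shift-cong (suc k) c≗g zero    = refl
shift-cong (suc k) c≗g (suc j) = shift-cong k c≗g j

shift-zero : ∀ k j → shift k (λ _ → 0) j ≡ 0
shift-zero zero    j       = refl
shift-zero (suc k) zero    = refl
shift-zero (suc k) (suc j) = shift-zero k j

add-balance : ∀ D e {t b₁ s b₂ b₃ c σ₀ c' p} →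
  t + D * b₁ ≡ s + e * b₂ + b₃ → s + D * c ≡ σ₀ + e * c' + p →
  t + D * (c + b₁) ≡ σ₀ + e * (c' + b₂) + (p + b₃)
add-balance D e {t} {b₁} {s} {b₂} {b₃} {c} {σ₀} {c'} {p} firing odo = begin
  t + D * (c + b₁)                ≡⟨ regroup₁ t D c b₁ ⟩
  (t + D * b₁) + D * c            ≡⟨ cong (_+ D * c) firing ⟩
  (s + e * b₂ + b₃) + D * c       ≡⟨ regroup₂ s e b₂ b₃ D c ⟩
  (s + D * c) + (e * b₂ + b₃)     ≡⟨ cong (_+ (e * b₂ + b₃)) odo ⟩
  (σ₀ + e * c' + p) + (e * b₂ + b₃) ≡⟨ regroup₃ σ₀ e c' p b₂ b₃ ⟩
  σ₀ + e * (c' + b₂) + (p + b₃)   ∎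
  where
  open ≡-Reasoning
  regroup₁ : ∀ t D c b → t + D * (c + b) ≡ (t + D * b) + D * c
  regroup₁ = solve-∀
  regroup₂ : ∀ s e b₂ b₃ D c → (s + e * b₂ + b₃) + D * c ≡ (s + D * c) + (e * b₂ + b₃)
  regroup₂ = solve-∀
  regroup₃ : ∀ σ₀ e c' p b₂ b₃ → (σ₀ + e * c' + p) + (e * b₂ + b₃) ≡ σ₀ + e * (c' + b₂) + (p + b₃)
  regroup₃ = solve-∀

n≰n∸1 : ∀ {n} → 1 ≤ n → ¬ (n ≤ n ∸ 1)
n≰n∸1 {suc n} _ = <-irrefl refl

module LeastAction (D : ℕ) (D≥2 : 2 ≤ D) (σ₀ : Config) where

  odometer-fire : ∀ {σ c i} → Odometer D σ₀ σ c → D ≤ σ i →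
                  Odometer D σ₀ (topple D i σ) (addShot c i)
  odometer-fire {σ} {c} {i} odo D≤σi j
    rewrite shift-addShot (D ∸ 1) c i j =
    add-balance D (D ∸ 1) {σ₀ = σ₀ j} {c (suc j)} {shift (D ∸ 1) c j}
                (topple-balance D D≥2 σ i D≤σi j) (odo j)

  -- A firing never pushes the odometer above a stabilizing function:
  -- at the fired column c i = g i would force σ i < D.
  addShot-≼ : ∀ {σ c i g} → Odometer D σ₀ σ c → D ≤ σ i →
              Stabilizing D σ₀ g → c ≼ g → addShot c i ≼ g
  addShot-≼ {σ} {c} {i} {g} odo D≤σi stab c≼g j with j ≡ᵇ i in j≡ᵇi
  ... | false = ≤-trans (≤-reflexive (+-identityʳ (c j))) (c≼g j)
  ... | true with refl ← ≡ᵇ-true {j} {i} j≡ᵇi with c j <? g j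
  ...   | yes cj<gj = ≤-trans (≤-reflexive (+-comm (c j) 1)) cj<gj
  ...   | no cj≮gj = ⊥-elim (D≰D∸1 (≤-trans D≤σi (+-cancelʳ-≤ (D * c j) (σ j) (D ∸ 1) bound)))
    where
    D≰D∸1 : ¬ (D ≤ D ∸ 1)
    D≰D∸1 = n≰n∸1 (≤-trans (n≤1+n 1) D≥2)
    bound : σ j + D * c j ≤ (D ∸ 1) + D * c j
    bound = begin
      σ j + D * c j                                      ≡⟨ odo j ⟩
      σ₀ j + (D ∸ 1) * c (suc j) + shift (D ∸ 1) c j     ≤⟨ +-mono-≤ (+-monoʳ-≤ (σ₀ j) (*-monoʳ-≤ (D ∸ 1) (c≼g (suc j))))
                                                                      (shift-mono (D ∸ 1) c≼g j) ⟩
      σ₀ j + (D ∸ 1) * g (suc j) + shift (D ∸ 1) g j     ≤⟨ stab j ⟩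
      (D ∸ 1) + D * g j                                  ≤⟨ +-monoʳ-≤ (D ∸ 1) (*-monoʳ-≤ D (≮⇒≥ cj≮gj)) ⟩
      (D ∸ 1) + D * c j                                  ∎
      where open ≤-Reasoning

  odometer-along : ∀ {σ τ c} → Odometer D σ₀ σ c → Reach D σ τ →
    Σ (ℕ → ℕ) λ c' → Odometer D σ₀ τ c' × (∀ g → Stabilizing D σ₀ g → c ≼ g → c' ≼ g)
  odometer-along {c = c} odo ε = c , odo , λ _ _ c≼g → c≼g
  odometer-along odo (fire σ i D≤σi ◅ run)
    with c' , odo' , below ← odometer-along (odometer-fire odo D≤σi) run =
    c' , odo' , λ g stab c≼g → below g stab (addShot-≼ odo D≤σi stab c≼g)

  odometer-initial : Odometer D σ₀ σ₀ (λ _ → 0)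
  odometer-initial j rewrite shift-zero (D ∸ 1) j
                           | *-zeroʳ D | *-zeroʳ (D ∸ 1) = sym (+-identityʳ (σ₀ j + 0))

  odometer : ∀ {τ} → Reach D σ₀ τ →
    Σ (ℕ → ℕ) λ c → Odometer D σ₀ τ c × (∀ g → Stabilizing D σ₀ g → c ≼ g)
  odometer run with c , odo , below ← odometer-along odometer-initial run =
    c , odo , λ g stab → below g stab (λ _ → z≤n)

  -- The odometer of a stable configuration is itself stabilizing,
  -- so it is the least stabilizing function.
  stable⇒stabilizing : ∀ {τ c} → Odometer D σ₀ τ c → Stable D τ → Stabilizing D σ₀ c
  stable⇒stabilizing {τ} {c} odo stable j =
    subst (_≤ (D ∸ 1) + D * c j) (odo j) (+-monoˡ-≤ (D * c j) (<⇒≤pred (stable j)))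

  stable-unique : ∀ {τ₁ τ₂} → Reach D σ₀ τ₁ → Stable D τ₁ → Reach D σ₀ τ₂ → Stable D τ₂ →
                  ∀ j → τ₁ j ≡ τ₂ j
  stable-unique {τ₁} {τ₂} run₁ stable₁ run₂ stable₂ j
    with c₁ , odo₁ , least₁ ← odometer run₁ | c₂ , odo₂ , least₂ ← odometer run₂ =
    +-cancelʳ-≡ (D * c₁ j) (τ₁ j) (τ₂ j) (begin
      τ₁ j + D * c₁ j                                  ≡⟨ odo₁ j ⟩
      σ₀ j + (D ∸ 1) * c₁ (suc j) + shift (D ∸ 1) c₁ j ≡⟨ cong₂ (λ x y → σ₀ j + (D ∸ 1) * x + y)
                                                                (c₁≗c₂ (suc j)) (shift-cong (D ∸ 1) c₁≗c₂ j) ⟩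
      σ₀ j + (D ∸ 1) * c₂ (suc j) + shift (D ∸ 1) c₂ j ≡⟨ odo₂ j ⟨
      τ₂ j + D * c₂ j                                  ≡⟨ cong (λ x → τ₂ j + D * x) (c₁≗c₂ j) ⟨
      τ₂ j + D * c₁ j                                  ∎)
    where
    open ≡-Reasoning
    c₁≗c₂ : ∀ j → c₁ j ≡ c₂ j
    c₁≗c₂ j = ≤-antisym (least₁ c₂ (stable⇒stabilizing odo₂ stable₂) j)
                        (least₂ c₁ (stable⇒stabilizing odo₁ stable₁) j)

-- KSPM(3) from N grains: the wedge j ↦ N ∸ j is stabilizing, so it bounds
-- the odometer of every run from (N, 0, 0, …).
wedge : ℕ → ℕ → ℕ
wedge N j = N ∸ j

two-neighbours : ∀ {a b x} → a ≤ x → b ≤ 2 + x → 0 + 2 * a + b ≤ 2 + 3 * x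
two-neighbours {a} {b} {x} a≤x b≤2+x = begin
  0 + 2 * a + b ≤⟨ +-mono-≤ (*-monoʳ-≤ 2 a≤x) b≤2+x ⟩
  2 * x + (2 + x) ≡⟨ regroup x ⟩
  2 + 3 * x ∎
  where
  open ≤-Reasoning
  regroup : ∀ x → 2 * x + (2 + x) ≡ 2 + 3 * x
  regroup = solve-∀

wedge-stabilizing : ∀ N → Stabilizing 3 (init N) (wedge N)
wedge-stabilizing N zero = begin
  N + 2 * (N ∸ 1) + 0 ≤⟨ +-monoˡ-≤ 0 (+-monoʳ-≤ N (*-monoʳ-≤ 2 (m∸n≤m N 1))) ⟩
  N + 2 * N + 0       ≤⟨ ≤-reflexive (triple N) ⟩
  3 * N               ≤⟨ m≤n+m (3 * N) 2 ⟩
  2 + 3 * N           ∎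
  where
  open ≤-Reasoning
  triple : ∀ n → n + 2 * n + 0 ≡ 3 * n
  triple = solve-∀
wedge-stabilizing N (suc zero) =
  two-neighbours (∸-monoʳ-≤ N (n≤1+n 1)) z≤n
wedge-stabilizing N (suc (suc k)) =
  two-neighbours (∸-monoʳ-≤ N (n≤1+n (2 + k)))
                 (subst (λ x → N ∸ k ≤ 2 + x) (trans (∸-+-assoc N k 2) (cong (N ∸_) (+-comm k 2)))
                        (m≤n+m∸n (N ∸ k) 2))

odometer-vanishes : ∀ {N c} → c ≼ wedge N → ∀ {j} → N ≤ j → c j ≡ 0
odometer-vanishes {N} {c} c≼w {j} N≤j = n≤0⇒n≡0 (subst (c j ≤_) (m≤n⇒m∸n≡0 N≤j) (c≼w j))

far-columns-empty : ∀ {N σ c} → Odometer 3 (init N) σ c → c ≼ wedge N →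
                    ∀ {j} → 2 + N ≤ j → σ j ≡ 0
far-columns-empty {N} {σ} {c} odo c≼w {suc (suc k)} (s≤s (s≤s N≤k)) =
  m+n≡0⇒m≡0 (σ (2 + k)) (begin
    σ (2 + k) + 3 * c (2 + k)   ≡⟨ odo (2 + k) ⟩
    0 + 2 * c (3 + k) + c k     ≡⟨ cong₂ (λ x y → 0 + 2 * x + y) (vanish 3) (vanish 0) ⟩
    0                           ∎)
  where
  open ≡-Reasoning
  vanish : ∀ m → c (m + k) ≡ 0
  vanish m = odometer-vanishes c≼w (≤-trans N≤k (m≤n+m k m))

-- Σ_{j<n} c j, the termination measure of stabilisation.
sumBelow : ℕ → (ℕ → ℕ) → ℕ
sumBelow zero    c = 0
sumBelow (suc n) c = sumBelow n c + c n

sumBelow-mono : ∀ n {c c'} → c ≼ c' → sumBelow n c ≤ sumBelow n c'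
sumBelow-mono zero    c≼c' = z≤n
sumBelow-mono (suc n) c≼c' = +-mono-≤ (sumBelow-mono n c≼c') (c≼c' n)

sumBelow-strict : ∀ n {c c' i} → c ≼ c' → c i < c' i → i < n → sumBelow n c < sumBelow n c'
sumBelow-strict (suc n) {i = i} c≼c' ci<c'i i<1+n with m≤n⇒m<n∨m≡n (s≤s⁻¹ i<1+n)
... | inj₁ i<n  = +-mono-<-≤ (sumBelow-strict n c≼c' ci<c'i i<n) (c≼c' n)
... | inj₂ refl = +-mono-≤-< (sumBelow-mono n c≼c') ci<c'i

sumBelow-wedge : ∀ {N c} → c ≼ wedge N → ∀ n → sumBelow n c ≤ n * N
sumBelow-wedge c≼w zero    = z≤n
sumBelow-wedge {N} {c} c≼w (suc n) =
  subst (sumBelow (suc n) c ≤_) (+-comm (n * N) N)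
        (+-mono-≤ (sumBelow-wedge c≼w n) (≤-trans (c≼w n) (m∸n≤m N n)))

firable? : ∀ n (σ : Config) → (Σ ℕ λ i → 3 ≤ σ i) ⊎ (∀ i → i < n → σ i < 3)
firable? n σ = decide (all? calm?)
  where
  calm? : (i : Fin n) → Dec (σ (toℕ i) < 3)
  calm? i = σ (toℕ i) <? 3
  decide : Dec (∀ i → σ (toℕ i) < 3) → (Σ ℕ λ i → 3 ≤ σ i) ⊎ (∀ i → i < n → σ i < 3)
  decide (yes calm) = inj₂ λ i i<n → subst (λ x → σ x < 3) (toℕ-fromℕ< i<n) (calm (fromℕ< i<n))
  decide (no ¬calm) =
    let i , σi≮3 = ¬∀⟶∃¬ n (λ i → σ (toℕ i) < 3) calm? ¬calm in inj₁ (toℕ i , ≮⇒≥ σi≮3)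

module Stabilisation (N : ℕ) where
  open LeastAction 3 (s≤s (s≤s z≤n)) (init N)

  -- A column that can fire lies left of N (the wedge vanishes from N on).
  fired-column-below-N : ∀ {c i} → addShot c i ≼ wedge N → i < N
  fired-column-below-N {c} {i} bound = ∸-cancelʳ-< (subst (_< N ∸ i) (sym (n∸n≡0 N)) (begin-strict
    0                 <⟨ s≤s z≤n ⟩
    suc (c i)         ≡⟨ addShot-at c i ⟨
    addShot c i i     ≤⟨ bound i ⟩
    N ∸ i             ∎))
    where open ≤-Reasoning

  -- Fire any unstable column among the first N + 2 as long as possible; the
  -- fuel K suffices because every firing raises Σ_{j<N} c j ≤ N·N.
  stabilise : ∀ K {σ c} → Odometer 3 (init N) σ c → c ≼ wedge N → N * N < sumBelow N c + K →
              Σ Config λ τ → Reach 3 σ τ × Stable 3 τ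
  stabilise zero {c = c} odo c≼w fuel =
    ⊥-elim (<⇒≱ (subst (N * N <_) (+-identityʳ (sumBelow N c)) fuel) (sumBelow-wedge c≼w N))
  stabilise (suc K) {σ} {c} odo c≼w fuel with firable? (2 + N) σ
  ... | inj₂ calm = σ , ε , stable
    where
    stable : Stable 3 σ
    stable i with i <? 2 + N
    ... | yes i<2+N = calm i i<2+N
    ... | no  i≮2+N = subst (_< 3) (sym (far-columns-empty {σ = σ} odo c≼w (≮⇒≥ i≮2+N))) z<s
  ... | inj₁ (i , 3≤σi) =
    let τ , run , stable = stabilise K (odometer-fire {σ} odo 3≤σi) c'≼w fuel'
    in  τ , fire σ i 3≤σi ◅ run , stable
    where
    c'≼w : addShot c i ≼ wedge N
    c'≼w = addShot-≼ {σ} odo 3≤σi (wedge-stabilizing N) c≼w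
    shot-at-i : c i < addShot c i i
    shot-at-i = subst (c i <_) (sym (addShot-at c i)) (n<1+n (c i))
    fuel' : N * N < sumBelow N (addShot c i) + K
    fuel' = <-≤-trans fuel (≤-trans (≤-reflexive (+-suc (sumBelow N c) K))
              (+-monoˡ-≤ K (sumBelow-strict N (λ j → m≤m+n (c j) _) shot-at-i (fired-column-below-N c'≼w))))

  stabilisation : Σ Config λ τ → Reach 3 (init N) τ × Stable 3 τ
  stabilisation = stabilise (suc (N * N)) odometer-initial (λ _ → z≤n) (m≤n+m (suc (N * N)) _)

half-≤ : ∀ n k → n + n ≤ suc (k + k) → n ≤ k
half-≤ zero    k       _ = z≤n
half-≤ (suc n) zero    (s≤s 2n+1≤0) rewrite +-suc n n with () ← 2n+1≤0
half-≤ (suc n) (suc k) (s≤s le) rewrite +-suc n n | +-suc k k = s≤s (half-≤ n k (s≤s⁻¹ le))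

halve : ∀ y k → y ℤ.+ y ℤ.≤ + suc (k + k) → y ℤ.≤ + k
halve -[1+ n ] k _              = ℤ.-≤+
halve (+ n)    k (ℤ.+≤+ le) = ℤ.+≤+ (half-≤ n k le)

module Halving {x y : ℤ} {t : ℕ} (t≤2 : t ≤ 2) (rec : (y ℤ.+ y) ℤ.+ x ℤ.+ + t ≡ 0ℤ) where

  double : y ℤ.+ y ≡ ℤ.- (x ℤ.+ + t)
  double = begin
    y ℤ.+ y                                            ≡⟨ solve y x (+ t) ⟩
    ((y ℤ.+ y) ℤ.+ x ℤ.+ + t) ℤ.- (x ℤ.+ + t)          ≡⟨ cong (ℤ._- (x ℤ.+ + t)) rec ⟩
    0ℤ ℤ.- (x ℤ.+ + t)                                 ≡⟨ ℤ.+-identityˡ _ ⟩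
    ℤ.- (x ℤ.+ + t)                                    ∎
    where
    open ≡-Reasoning
    solve : ∀ y x t → y ℤ.+ y ≡ ((y ℤ.+ y) ℤ.+ x ℤ.+ t) ℤ.- (x ℤ.+ t)
    solve = ℤ-Ring.solve-∀

  upper : ∀ k → ℤ.- x ℤ.≤ + suc (k + k) → y ℤ.≤ + k
  upper k -x≤ = halve y k (begin
    y ℤ.+ y            ≡⟨ double ⟩
    ℤ.- (x ℤ.+ + t)    ≤⟨ ℤ.neg-mono-≤ (ℤ.i≤i+j x (+ t)) ⟩
    ℤ.- x              ≤⟨ -x≤ ⟩
    + suc (k + k)      ∎)
    where open ℤ.≤-Reasoning

  lower : ∀ k → x ℤ.≤ + suc (k + k) → ℤ.- y ℤ.≤ + suc k
  lower k x≤ = halve (ℤ.- y) (suc k) (begin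
    ℤ.- y ℤ.+ ℤ.- y    ≡⟨ ℤ.neg-distrib-+ y y ⟨
    ℤ.- (y ℤ.+ y)      ≡⟨ cong ℤ.-_ double ⟩
    ℤ.- ℤ.- (x ℤ.+ + t) ≡⟨ ℤ.neg-involutive _ ⟩
    x ℤ.+ + t          ≤⟨ ℤ.+-mono-≤ x≤ (ℤ.+≤+ t≤2) ⟩
    + (suc (k + k) + 2) ≡⟨ cong +_ (arith k) ⟩
    + suc (suc k + suc k) ∎)
    where
    open ℤ.≤-Reasoning
    arith : ∀ k → suc (k + k) + 2 ≡ suc (suc k + suc k)
    arith = solve-∀

  absolute : ∣ y ∣ + ∣ y ∣ ≤ ∣ x ∣ + 2
  absolute = begin
    ∣ y ∣ + ∣ y ∣        ≡⟨ ∣i+i∣ y ⟨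
    ∣ y ℤ.+ y ∣          ≡⟨ cong ∣_∣ double ⟩
    ∣ ℤ.- (x ℤ.+ + t) ∣  ≡⟨ ℤ.∣-i∣≡∣i∣ (x ℤ.+ + t) ⟩
    ∣ x ℤ.+ + t ∣        ≤⟨ ℤ.∣i+j∣≤∣i∣+∣j∣ x (+ t) ⟩
    ∣ x ∣ + t            ≤⟨ +-monoʳ-≤ ∣ x ∣ t≤2 ⟩
    ∣ x ∣ + 2            ∎
    where
    open ≤-Reasoning
    ∣i+i∣ : ∀ i → ∣ i ℤ.+ i ∣ ≡ ∣ i ∣ + ∣ i ∣
    ∣i+i∣ (+ n)    = refl
    ∣i+i∣ -[1+ n ] = cong suc (sym (+-suc n n))

-i≤∣i∣ : ∀ x → ℤ.- x ℤ.≤ + ∣ x ∣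
-i≤∣i∣ (+ zero)    = ℤ.+≤+ z≤n
-i≤∣i∣ (+ suc n)   = ℤ.-≤+
-i≤∣i∣ -[1+ n ]    = ℤ.≤-refl

unit-nonpositive : ∀ {x} → x ℤ.≤ 0ℤ → ℤ.- x ℤ.≤ + 1 → ∣ x ∣ ≤ 1 × x ≡ ℤ.- + ∣ x ∣
unit-nonpositive {+ zero}    _ _                 = z≤n , refl
unit-nonpositive {+ suc n}   (ℤ.+≤+ ()) _
unit-nonpositive { -[1+ n ]} _ (ℤ.+≤+ (s≤s n≤0)) = s≤s n≤0 , refl

difference-to-ℕ : ∀ P Q b → + P ℤ.- + Q ≡ ℤ.- + b → Q ≡ P + b
difference-to-ℕ P Q b eq = ℤ.+-injective (begin
  + Q                          ≡⟨ regroup (+ P) (+ Q) ⟩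
  + P ℤ.- (+ P ℤ.- + Q)        ≡⟨ cong (λ z → + P ℤ.- z) eq ⟩
  + P ℤ.- ℤ.- + b              ≡⟨ cong (λ z → + P ℤ.+ z) (ℤ.neg-involutive (+ b)) ⟩
  + (P + b)                    ∎)
  where
  open ≡-Reasoning
  regroup : ∀ p q → q ≡ p ℤ.- (p ℤ.- q)
  regroup = ℤ-Ring.solve-∀

recurrence-to-ℕ : ∀ B A t → (ℤ.- + B ℤ.+ ℤ.- + B) ℤ.+ ℤ.- + A ℤ.+ + t ≡ 0ℤ → t ≡ 2 * B + A
recurrence-to-ℕ B A t eq = ℤ.+-injective (begin
  + t                                                    ≡⟨ regroup (+ B) (+ A) (+ t) ⟩
  ((ℤ.- + B ℤ.+ ℤ.- + B) ℤ.+ ℤ.- + A ℤ.+ + t) ℤ.+ + (2 * B + A) ≡⟨ cong (ℤ._+ + (2 * B + A)) eq ⟩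
  0ℤ ℤ.+ + (2 * B + A)                                   ≡⟨ ℤ.+-identityˡ _ ⟩
  + (2 * B + A)                                          ∎)
  where
  open ≡-Reasoning
  regroup : ∀ b a t → t ≡ ((ℤ.- b ℤ.+ ℤ.- b) ℤ.+ ℤ.- a ℤ.+ t) ℤ.+ (b ℤ.+ (b ℤ.+ 0ℤ) ℤ.+ a)
  regroup = ℤ-Ring.solve-∀

-- The odometer equation t + 3C = 2D + A at column j + 1, rewritten for the
-- second differences e_j = 2B − C − A and e_{j+1} = 2C − D − B:
-- 2 e_{j+1} + e_j + t = 0.
second-difference-recurrence : ∀ t A B C D →
  t ℤ.+ (C ℤ.+ (C ℤ.+ C)) ≡ (D ℤ.+ D) ℤ.+ A →
  ((C ℤ.+ C ℤ.- (D ℤ.+ B)) ℤ.+ (C ℤ.+ C ℤ.- (D ℤ.+ B))) ℤ.+ (B ℤ.+ B ℤ.- (C ℤ.+ A)) ℤ.+ t ≡ 0ℤ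
second-difference-recurrence t A B C D eq = begin
  ((C ℤ.+ C ℤ.- (D ℤ.+ B)) ℤ.+ (C ℤ.+ C ℤ.- (D ℤ.+ B))) ℤ.+ (B ℤ.+ B ℤ.- (C ℤ.+ A)) ℤ.+ t
    ≡⟨ regroup t A B C D ⟩
  (t ℤ.+ (C ℤ.+ (C ℤ.+ C))) ℤ.- ((D ℤ.+ D) ℤ.+ A)
    ≡⟨ cong (ℤ._- ((D ℤ.+ D) ℤ.+ A)) eq ⟩
  ((D ℤ.+ D) ℤ.+ A) ℤ.- ((D ℤ.+ D) ℤ.+ A)
    ≡⟨ ℤ.+-inverseʳ ((D ℤ.+ D) ℤ.+ A) ⟩
  0ℤ ∎
  where
  open ≡-Reasoning
  regroup : ∀ t A B C D →
    ((C ℤ.+ C ℤ.- (D ℤ.+ B)) ℤ.+ (C ℤ.+ C ℤ.- (D ℤ.+ B))) ℤ.+ (B ℤ.+ B ℤ.- (C ℤ.+ A)) ℤ.+ t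
      ≡ (t ℤ.+ (C ℤ.+ (C ℤ.+ C))) ℤ.- ((D ℤ.+ D) ℤ.+ A)
  regroup = ℤ-Ring.solve-∀

stable-≤2 : ∀ {τ} → Stable 3 τ → ∀ j → τ j ≤ 2
stable-≤2 stable j = s≤s⁻¹ (stable j)

-- Let c be the odometer of a stable τ and
-- the least stabilizing function for σ₀ (D = 3).  Then no block [a, b] with
-- a + 2 ≤ b carries c ≥ 1 while τ_a, τ_{a+1} ≤ 1 and τ_b = 0: removing one
-- firing from every column of the block would leave a stabilizing function.
module NoLowerableBlock {σ₀ τ c} (odo : Odometer 3 σ₀ τ c) (stable : Stable 3 τ)
    (least : ∀ g → Stabilizing 3 σ₀ g → c ≼ g)
    {a b : ℕ} (a+2≤b : 2 + a ≤ b) (τa≤1 : τ a ≤ 1) (τa+1≤1 : τ (suc a) ≤ 1) (τb≡0 : τ b ≡ 0)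
    (positive : ∀ j → a ≤ j → j ≤ b → 1 ≤ c j) where

  block : ℕ → ℕ
  block j with a ≤? j | j ≤? b
  ... | yes _ | yes _ = 1
  ... | _     | _     = 0

  block-in : ∀ {j} → a ≤ j → j ≤ b → block j ≡ 1
  block-in {j} a≤j j≤b with a ≤? j | j ≤? b
  ... | yes _   | yes _   = refl
  ... | no a≰j  | _       = ⊥-elim (a≰j a≤j)
  ... | yes _   | no j≰b  = ⊥-elim (j≰b j≤b)

  block-view : ∀ j → block j ≡ 0 ⊎ (a ≤ j × j ≤ b)
  block-view j with a ≤? j | j ≤? b
  ... | yes a≤j | yes j≤b = inj₂ (a≤j , j≤b)
  ... | yes _   | no _    = inj₁ refl
  ... | no _    | _       = inj₁ refl

  block-two-left : ∀ {j} → 2 + a ≤ j → j ≤ b → shift 2 block j ≡ 1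
  block-two-left {suc (suc k)} (s≤s (s≤s a≤k)) k+2≤b = block-in a≤k (≤-trans (m≤n+m k 2) k+2≤b)

  at-end : τ b + 3 ≤ 2 + 2 * block (suc b) + shift 2 block b
  at-end = begin
    τ b + 3                       ≡⟨ cong (_+ 3) τb≡0 ⟩
    3                             ≤⟨ m≤m+n 3 (2 * block (suc b)) ⟩
    3 + 2 * block (suc b)         ≡⟨ arith (block (suc b)) ⟩
    2 + 2 * block (suc b) + 1     ≡⟨ cong (λ x → 2 + 2 * block (suc b) + x) (block-two-left a+2≤b ≤-refl) ⟨
    2 + 2 * block (suc b) + shift 2 block b ∎
    where
    open ≤-Reasoning
    arith : ∀ x → 3 + 2 * x ≡ 2 + 2 * x + 1
    arith = solve-∀

  -- Inside the block, untoppling once at every column keeps τ stable: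
  -- τ_j + 3 ≤ 2 + 2·block_{j+1} + block_{j−2}.
  inside : ∀ {j} → a ≤ j → j ≤ b → τ j + 3 ≤ 2 + 2 * block (suc j) + shift 2 block j
  inside {j} a≤j j≤b = by-position (suc j ≤? b) (j ≤? suc a)
    where
    by-position : Dec (suc j ≤ b) → Dec (j ≤ suc a) →
                  τ j + 3 ≤ 2 + 2 * block (suc j) + shift 2 block j
    by-position (yes j<b) (yes j≤a+1)
      rewrite block-in (≤-trans a≤j (n≤1+n j)) j<b =
        ≤-trans (+-monoˡ-≤ 3 near-start) (m≤m+n 4 (shift 2 block j))
      where
      near-start : τ j ≤ 1
      near-start with m≤n⇒m<n∨m≡n j≤a+1
      ... | inj₁ j<a+1 = subst (λ i → τ i ≤ 1) (sym (≤-antisym (s≤s⁻¹ j<a+1) a≤j)) τa≤1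
      ... | inj₂ j≡a+1 = subst (λ i → τ i ≤ 1) (sym j≡a+1) τa+1≤1
    by-position (yes j<b) (no j≰a+1)
      rewrite block-in (≤-trans a≤j (n≤1+n j)) j<b | block-two-left (≰⇒> j≰a+1) j≤b =
        +-monoˡ-≤ 3 (stable-≤2 stable j)
    by-position (no j≮b) _ =
      subst (λ i → τ i + 3 ≤ 2 + 2 * block (suc i) + shift 2 block i)
            (sym (≤-antisym j≤b (≮⇒≥ j≮b))) at-end

  untopple-block : ∀ j → τ j + 3 * block j ≤ 2 + 2 * block (suc j) + shift 2 block j
  untopple-block j with block-view j
  ... | inj₁ outside rewrite outside =
    ≤-trans (≤-reflexive (+-identityʳ (τ j))) (≤-trans (stable-≤2 stable j) (≤-trans (m≤m+n 2 (2 * block (suc j))) (m≤m+n _ (shift 2 block j))))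
  ... | inj₂ (a≤j , j≤b) rewrite block-in a≤j j≤b = inside a≤j j≤b

  block≼c : block ≼ c
  block≼c j with block-view j
  ... | inj₁ outside     = subst (_≤ c j) (sym outside) z≤n
  ... | inj₂ (a≤j , j≤b) = subst (_≤ c j) (sym (block-in a≤j j≤b)) (positive j a≤j j≤b)

  lowered : ℕ → ℕ
  lowered j = c j ∸ block j

  lowered+block : ∀ j → lowered j + block j ≡ c j
  lowered+block j = m∸n+n≡m (block≼c j)

  shifted-lowered+block : ∀ j → shift 2 lowered j + shift 2 block j ≡ shift 2 c j
  shifted-lowered+block zero          = refl
  shifted-lowered+block (suc zero)    = refl
  shifted-lowered+block (suc (suc j)) = lowered+block j

  lowered-stabilizing : Stabilizing 3 σ₀ lowered
  lowered-stabilizing j = +-cancelʳ-≤ (2 * block (suc j) + shift 2 block j) _ _ (begin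
    σ₀ j + 2 * lowered (suc j) + shift 2 lowered j + (2 * block (suc j) + shift 2 block j)
      ≡⟨ regroup₁ (σ₀ j) (lowered (suc j)) (shift 2 lowered j) (block (suc j)) (shift 2 block j) ⟩
    σ₀ j + 2 * (lowered (suc j) + block (suc j)) + (shift 2 lowered j + shift 2 block j)
      ≡⟨ cong₂ (λ x y → σ₀ j + 2 * x + y) (lowered+block (suc j)) (shifted-lowered+block j) ⟩
    σ₀ j + 2 * c (suc j) + shift 2 c j
      ≡⟨ odo j ⟨
    τ j + 3 * c j
      ≡⟨ cong (λ x → τ j + 3 * x) (lowered+block j) ⟨
    τ j + 3 * (lowered j + block j)
      ≡⟨ regroup₂ (τ j) (lowered j) (block j) ⟩
    (τ j + 3 * block j) + 3 * lowered j
      ≤⟨ +-monoˡ-≤ (3 * lowered j) (untopple-block j) ⟩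
    2 + 2 * block (suc j) + shift 2 block j + 3 * lowered j
      ≡⟨ regroup₃ (block (suc j)) (shift 2 block j) (lowered j) ⟩
    2 + 3 * lowered j + (2 * block (suc j) + shift 2 block j) ∎)
    where
    open ≤-Reasoning
    regroup₁ : ∀ s l p b q → s + 2 * l + p + (2 * b + q) ≡ s + 2 * (l + b) + (p + q)
    regroup₁ = solve-∀
    regroup₂ : ∀ t l b → t + 3 * (l + b) ≡ (t + 3 * b) + 3 * l
    regroup₂ = solve-∀
    regroup₃ : ∀ b q l → 2 + 2 * b + q + 3 * l ≡ 2 + 3 * l + (2 * b + q)
    regroup₃ = solve-∀

  impossible : ⊥
  impossible = <-irrefl refl (begin-strict
    lowered a + 1 ≡⟨ cong (λ x → lowered a + x) (block-in ≤-refl (≤-trans (m≤n+m a 2) a+2≤b)) ⟨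
    lowered a + block a ≡⟨ lowered+block a ⟩
    c a                 ≤⟨ least lowered lowered-stabilizing a ⟩
    lowered a           <⟨ n<1+n (lowered a) ⟩
    suc (lowered a)     ≡⟨ +-comm 1 (lowered a) ⟩
    lowered a + 1       ∎)
    where open ≤-Reasoning

blocks : ℕ → List ℕ
blocks m = concat (replicate m (2 ∷ 1 ∷ []))

blocks-++ : ∀ m m' → blocks m ++ blocks m' ≡ blocks (m + m')
blocks-++ zero    m' = refl
blocks-++ (suc m) m' = cong (λ xs → 2 ∷ 1 ∷ xs) (blocks-++ m m')

listSeq-++ : ∀ xs ys k → listSeq (xs ++ ys) (length xs + k) ≡ listSeq ys k
listSeq-++ []       ys k = refl
listSeq-++ (x ∷ xs) ys k = listSeq-++ xs ys k

listSeq-trailing-zero : ∀ xs k → listSeq (xs ++ 0 ∷ []) k ≡ listSeq xs k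
listSeq-trailing-zero []       zero    = refl
listSeq-trailing-zero []       (suc k) = refl
listSeq-trailing-zero (x ∷ xs) zero    = refl
listSeq-trailing-zero (x ∷ xs) (suc k) = listSeq-trailing-zero xs k

TailShape : Config → ℕ → Set
TailShape τ q = Σ ℕ λ m → Σ ℕ λ e → Σ ℕ λ m' → e ≤ 1 ×
                  ((k : ℕ) → τ (q + k) ≡ listSeq (pattern21 m e m') k)

tail-cons-21 : ∀ {τ q} → τ q ≡ 2 → τ (suc q) ≡ 1 → TailShape τ (2 + q) → TailShape τ q
tail-cons-21 {τ} {q} τq≡2 τq+1≡1 (m , e , m' , e≤1 , rest) = suc m , e , m' , e≤1 , reads
  where
  reads : ∀ k → τ (q + k) ≡ listSeq (pattern21 (suc m) e m') k
  reads zero          = trans (cong τ (+-identityʳ q)) τq≡2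
  reads (suc zero)    = trans (cong τ (+-comm q 1)) τq+1≡1
  reads (suc (suc k)) = trans (cong τ (trans (+-suc q (suc k)) (cong suc (+-suc q k)))) (rest k)

tail-cons-0 : ∀ {τ q m} → τ q ≡ 0 → (∀ k → τ (suc q + k) ≡ listSeq (blocks m) k) → TailShape τ q
tail-cons-0 {τ} {q} {m} τq≡0 rest = 0 , 1 , m , ≤-refl , reads
  where
  reads : ∀ k → τ (q + k) ≡ listSeq (pattern21 0 1 m) k
  reads zero    = trans (cong τ (+-identityʳ q)) τq≡0
  reads (suc k) = trans (cong τ (+-suc q k)) (rest k)

bit-cases : ∀ {x} → x ≤ 1 → x ≡ 0 ⊎ x ≡ 1
bit-cases {zero}  _         = inj₁ refl
bit-cases {suc _} (s≤s z≤n) = inj₂ refl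

module StableShape (N L : ℕ) (3N<2^L : 3 * N < 2 ^ L) {τ : Config} {c : ℕ → ℕ}
    (odo : Odometer 3 (init N) τ c) (stable : Stable 3 τ)
    (least : ∀ g → Stabilizing 3 (init N) g → c ≼ g) where

  c≼wedge : c ≼ wedge N
  c≼wedge = least (wedge N) (wedge-stabilizing N)

  defect : ℕ → ℤ
  defect j = + (c j + c j) ℤ.- + (c (suc j) + shift 1 c j)

  recurrence : ∀ j → (defect (suc j) ℤ.+ defect (suc j)) ℤ.+ defect j ℤ.+ + τ (suc j) ≡ 0ℤ
  recurrence j = second-difference-recurrence (+ τ (suc j)) (+ shift 1 c j) (+ c j)
                   (+ c (suc j)) (+ c (2 + j)) (cong +_ (reshape {τ (suc j)} {shift 1 c j} {c (suc j)} {c (2 + j)} (odo (suc j))))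
    where
    reshape : ∀ {t A C D} → t + 3 * C ≡ 0 + 2 * D + A → t + (C + (C + C)) ≡ (D + D) + A
    reshape {t} {A} {C} {D} eq = trans (arith₁ t C) (trans eq (arith₂ D A))
      where
      arith₁ : ∀ t C → t + (C + (C + C)) ≡ t + 3 * C
      arith₁ = solve-∀
      arith₂ : ∀ D A → 0 + 2 * D + A ≡ (D + D) + A
      arith₂ = solve-∀

  module Next j = Halving {defect j} {defect (suc j)} (stable-≤2 stable (suc j)) (recurrence j)

  -- At column 0 the second difference is at most 3N (c ≤ N there).
  defect-start : ∣ defect 0 ∣ ≤ 3 * N
  defect-start = begin
    ∣ defect 0 ∣                ≤⟨ ℤ.∣i-j∣≤∣i∣+∣j∣ (+ (c 0 + c 0)) (+ (c 1 + 0)) ⟩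
    (c 0 + c 0) + (c 1 + 0)     ≤⟨ +-mono-≤ (+-mono-≤ (c≼wedge 0) (c≼wedge 0))
                                            (+-monoˡ-≤ 0 (≤-trans (c≼wedge 1) (m∸n≤m N 1))) ⟩
    (N + N) + (N + 0)           ≡⟨ triple N ⟩
    3 * N                       ∎
    where
    open ≤-Reasoning
    triple : ∀ n → (n + n) + (n + 0) ≡ 3 * n
    triple = solve-∀

  -- Since |e| at least halves up to an additive 2 at each step,
  -- 2^j |e_j| ≤ 3N + 2·2^j …
  defect-decay : ∀ j → 2 ^ j * ∣ defect j ∣ ≤ 3 * N + 2 ^ j * 2
  defect-decay zero = ≤-trans (≤-reflexive (+-identityʳ _)) (≤-trans defect-start (m≤m+n (3 * N) 2))
  defect-decay (suc j) = begin
    2 ^ suc j * a′                   ≡⟨ arith₁ (2 ^ j) a′ ⟩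
    2 ^ j * (a′ + a′)                ≤⟨ *-monoʳ-≤ (2 ^ j) (Next.absolute j) ⟩
    2 ^ j * (∣ defect j ∣ + 2)        ≡⟨ *-distribˡ-+ (2 ^ j) ∣ defect j ∣ 2 ⟩
    2 ^ j * ∣ defect j ∣ + 2 ^ j * 2  ≤⟨ +-monoˡ-≤ (2 ^ j * 2) (defect-decay j) ⟩
    3 * N + 2 ^ j * 2 + 2 ^ j * 2    ≡⟨ arith₂ (3 * N) (2 ^ j) ⟩
    3 * N + 2 ^ suc j * 2            ∎
    where
    open ≤-Reasoning
    a′ : ℕ
    a′ = ∣ defect (suc j) ∣
    arith₁ : ∀ p a → 2 * p * a ≡ p * (a + a)
    arith₁ = solve-∀
    arith₂ : ∀ m p → m + p * 2 + p * 2 ≡ m + 2 * p * 2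
    arith₂ = solve-∀

  defect-small : ∀ {j} → L ≤ j → ∣ defect j ∣ ≤ 2
  defect-small {j} L≤j with ∣ defect j ∣ ≤? 2
  ... | yes small = small
  ... | no  large = ⊥-elim (<⇒≱ 3N<2^j (+-cancelˡ-≤ (2 ^ j * 2) _ _ (begin
    2 ^ j * 2 + 2 ^ j   ≡⟨ arith (2 ^ j) ⟩
    2 ^ j * 3           ≤⟨ *-monoʳ-≤ (2 ^ j) (≰⇒> large) ⟩
    2 ^ j * ∣ defect j ∣ ≤⟨ defect-decay j ⟩
    3 * N + 2 ^ j * 2   ≡⟨ +-comm (3 * N) _ ⟩
    2 ^ j * 2 + 3 * N   ∎)))
    where
    open ≤-Reasoning
    3N<2^j : 3 * N < 2 ^ j
    3N<2^j = <-≤-trans 3N<2^L (^-monoʳ-≤ 2 L≤j)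
    arith : ∀ p → p * 2 + p ≡ p * 3
    arith = solve-∀

  -- Three more steps of the recurrence squeeze e into [−1, 0].
  defect-≤1 : ∀ {j} → L ≤ j → defect (suc j) ℤ.≤ + 1
  defect-≤1 {j} L≤j =
    Next.upper j 1 (ℤ.≤-trans (-i≤∣i∣ (defect j)) (ℤ.+≤+ (≤-trans (defect-small L≤j) (n≤1+n 2))))

  defect-≥-1 : ∀ {j} → L ≤ j → ℤ.- defect (2 + j) ℤ.≤ + 1
  defect-≥-1 {j} L≤j = Next.lower (suc j) 0 (defect-≤1 L≤j)

  defect-≤0 : ∀ {j} → L ≤ j → defect (3 + j) ℤ.≤ 0ℤ
  defect-≤0 {j} L≤j = Next.upper (2 + j) 0 (defect-≥-1 L≤j)

  j₀ : ℕ
  j₀ = 3 + L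

  kink : ℕ → ℕ
  kink j = ∣ defect j ∣

  kink-unit : ∀ {j} → j₀ ≤ j → kink j ≤ 1 × defect j ≡ ℤ.- + kink j
  kink-unit {suc (suc (suc j))} (s≤s (s≤s (s≤s L≤j))) =
    unit-nonpositive (defect-≤0 L≤j) (defect-≥-1 (≤-trans L≤j (n≤1+n j)))

  kink-cases : ∀ {j} → j₀ ≤ j → kink j ≡ 0 ⊎ kink j ≡ 1
  kink-cases j₀≤j = bit-cases (proj₁ (kink-unit j₀≤j))

  convex : ∀ {j} → j₀ ≤ j → c (suc j) + shift 1 c j ≡ (c j + c j) + kink j
  convex j₀≤j = difference-to-ℕ _ _ _ (proj₂ (kink-unit j₀≤j))

  reading : ∀ {j} → j₀ ≤ j → τ (suc j) ≡ 2 * kink (suc j) + kink j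
  reading {j} j₀≤j = recurrence-to-ℕ (kink (suc j)) (kink j) (τ (suc j))
    (subst₂ (λ y x → (y ℤ.+ y) ℤ.+ x ℤ.+ + τ (suc j) ≡ 0ℤ)
            (proj₂ (kink-unit (≤-trans j₀≤j (n≤1+n j)))) (proj₂ (kink-unit j₀≤j)) (recurrence j))

  -- Kinks are isolated, since τ ≤ 2.
  kink-isolated : ∀ {j} → j₀ ≤ j → kink j ≡ 1 → kink (suc j) ≡ 0
  kink-isolated {j} j₀≤j kink≡1 with kink-cases (≤-trans j₀≤j (n≤1+n j))
  ... | inj₁ kink′≡0 = kink′≡0
  ... | inj₂ kink′≡1 = ⊥-elim (<⇒≱ (s≤s (stable-≤2 stable (suc j)))
                         (≤-reflexive (sym (trans (reading j₀≤j) (cong₂ (λ a b → 2 * a + b) kink′≡1 kink≡1)))))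

  -- Convex from j₀ on and zero from N on, the odometer is non-increasing
  -- from j₀ on (induction on the distance n to N).
  nonincreasing-within : ∀ n {j} → N ≤ j + n → j₀ ≤ j → c (suc j) ≤ c j
  nonincreasing-within zero {j} N≤j _ =
    subst (_≤ c j) (sym (odometer-vanishes c≼wedge (≤-trans (subst (N ≤_) (+-identityʳ j) N≤j) (n≤1+n j))))
          z≤n
  nonincreasing-within (suc n) {j} N≤j+1+n j₀≤j = +-cancelˡ-≤ (c (suc j)) _ _ (begin
    c (suc j) + c (suc j)              ≤⟨ m≤m+n _ (kink (suc j)) ⟩
    c (suc j) + c (suc j) + kink (suc j) ≡⟨ convex (≤-trans j₀≤j (n≤1+n j)) ⟨
    c (2 + j) + c j                    ≤⟨ +-monoˡ-≤ (c j) next ⟩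
    c (suc j) + c j                    ∎)
    where
    open ≤-Reasoning
    next : c (2 + j) ≤ c (suc j)
    next = nonincreasing-within n (subst (N ≤_) (+-suc j n) N≤j+1+n) (≤-trans j₀≤j (n≤1+n j))

  nonincreasing : ∀ {j} → j₀ ≤ j → c (suc j) ≤ c j
  nonincreasing {j} = nonincreasing-within N (m≤n+m N j)

  nonincreasing-range : ∀ {i} k → j₀ ≤ i → c (i + k) ≤ c i
  nonincreasing-range {i} zero    _    = ≤-reflexive (cong c (+-identityʳ i))
  nonincreasing-range {i} (suc k) j₀≤i = begin
    c (i + suc k) ≡⟨ cong c (+-suc i k) ⟩
    c (suc (i + k)) ≤⟨ nonincreasing (≤-trans j₀≤i (m≤m+n i k)) ⟩
    c (i + k)     ≤⟨ nonincreasing-range k j₀≤i ⟩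
    c i           ∎
    where open ≤-Reasoning

  -- Left of a kink the odometer is positive: c_{v+2} ≤ c_{v+1} and
  -- c_{v+2} + c_v = 2c_{v+1} + 1 give c_v > c_{v+1}.
  positive-before-kink : ∀ {v} → j₀ ≤ v → kink (suc v) ≡ 1 → 1 ≤ c v
  positive-before-kink {v} j₀≤v kink≡1 = ≤-trans (m≤n+m 1 (c (suc v))) (+-cancelˡ-≤ (c (suc v)) _ _ (begin
    c (suc v) + (c (suc v) + 1)          ≡⟨ +-assoc (c (suc v)) (c (suc v)) 1 ⟨
    c (suc v) + c (suc v) + 1            ≡⟨ cong (λ k → c (suc v) + c (suc v) + k) kink≡1 ⟨
    c (suc v) + c (suc v) + kink (suc v) ≡⟨ convex (≤-trans j₀≤v (n≤1+n v)) ⟨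
    c (2 + v) + c v                      ≤⟨ +-monoˡ-≤ (c v) (nonincreasing (≤-trans j₀≤v (n≤1+n v))) ⟩
    c (suc v) + c v                      ∎))
    where open ≤-Reasoning

  -- A 0 at column s + 2 ≥ j₀ + 2 is never followed, further right, by 0, 2:
  -- otherwise the odometer could be lowered on the block [s + 1, b].
  no-second-gap : ∀ {s b} → j₀ ≤ s → τ (2 + s) ≡ 0 → 3 + s ≤ b → τ b ≡ 0 → τ (suc b) ≡ 2 → ⊥
  no-second-gap {s} {b} j₀≤s τs+2≡0 s+3≤b τb≡0 τb+1≡2 =
    NoLowerableBlock.impossible {init N} odo stable least
      s+3≤b τs+1≤1 (subst (_≤ 1) (sym τs+2≡0) z≤n) τb≡0 positive
    where
    j₀≤b : j₀ ≤ b
    j₀≤b = ≤-trans j₀≤s (≤-trans (m≤n+m s 3) s+3≤b)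
    kink-s+1 : kink (suc s) ≡ 0
    kink-s+1 = m+n≡0⇒n≡0 (2 * kink (2 + s)) (trans (sym (reading (≤-trans j₀≤s (n≤1+n s)))) τs+2≡0)
    τs+1≤1 : τ (suc s) ≤ 1
    τs+1≤1 = subst (_≤ 1) (sym (trans (reading j₀≤s) (cong (λ k → 2 * k + kink s) kink-s+1)))
                   (proj₁ (kink-unit j₀≤s))
    kink-b+1 : kink (suc b) ≡ 1
    kink-b+1 with kink-cases (≤-trans j₀≤b (n≤1+n b))
    ... | inj₂ kink≡1 = kink≡1
    ... | inj₁ kink≡0 = ⊥-elim (<⇒≱ (s≤s (proj₁ (kink-unit j₀≤b)))
                          (≤-reflexive (trans (sym τb+1≡2) (trans (reading j₀≤b) (cong (λ k → 2 * k + kink b) kink≡0)))))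
    positive : ∀ j → suc s ≤ j → j ≤ b → 1 ≤ c j
    positive j s<j j≤b = ≤-trans (positive-before-kink j₀≤b kink-b+1)
      (subst (λ i → c i ≤ c j) (m+[n∸m]≡n j≤b) (nonincreasing-range (b ∸ j) (≤-trans j₀≤s (≤-trans (n≤1+n s) s<j))))

  -- Scanning right from a column 2 + s whose left kink is absent, until
  -- column N (fuel n): every read-off is (2,1)^m 0^e (2,1)^{m'} 0^ω.
  tail-from : ∀ n {s} → N ≤ s + n → j₀ ≤ s → kink (suc s) ≡ 0 → TailShape τ (2 + s)
  tail-from zero {s} N≤s _ _ = 0 , 0 , 0 , z≤n , λ k →
    far-columns-empty {σ = τ} odo c≼wedge (s≤s (s≤s (≤-trans (subst (N ≤_) (+-identityʳ s) N≤s) (m≤m+n s k))))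
  tail-from (suc n) {s} N≤s+1+n j₀≤s kink-s+1≡0 with kink-cases (≤-trans j₀≤s (m≤n+m s 2))
  ... | inj₂ kink-s+2≡1 = tail-cons-21 {τ} τs+2≡2 τs+3≡1
          (tail-from n (≤-trans N≤s+1+n (≤-trans (≤-reflexive (+-suc s n)) (n≤1+n _))) j₀≤s+2 kink-s+3≡0)
    where
    j₀≤s+2 : j₀ ≤ 2 + s
    j₀≤s+2 = ≤-trans j₀≤s (m≤n+m s 2)
    kink-s+3≡0 : kink (3 + s) ≡ 0
    kink-s+3≡0 = kink-isolated j₀≤s+2 kink-s+2≡1
    τs+2≡2 : τ (2 + s) ≡ 2
    τs+2≡2 = trans (reading (≤-trans j₀≤s (n≤1+n s))) (cong₂ (λ x y → 2 * x + y) kink-s+2≡1 kink-s+1≡0)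
    τs+3≡1 : τ (3 + s) ≡ 1
    τs+3≡1 = trans (reading j₀≤s+2) (cong₂ (λ x y → 2 * x + y) kink-s+3≡0 kink-s+2≡1)
  ... | inj₁ kink-s+2≡0 =
    prepend-0 (tail-from n (subst (N ≤_) (+-suc s n) N≤s+1+n) (≤-trans j₀≤s (n≤1+n s)) kink-s+2≡0)
    where
    τs+2≡0 : τ (2 + s) ≡ 0
    τs+2≡0 = trans (reading (≤-trans j₀≤s (n≤1+n s))) (cong₂ (λ x y → 2 * x + y) kink-s+2≡0 kink-s+1≡0)
    -- A 0 in front of (2,1)^m 0^e (2,1)^{m'}: a second 0 would be a forbidden gap.
    prepend-0 : TailShape τ (3 + s) → TailShape τ (2 + s)
    prepend-0 (m , 0 , m' , _ , rest) =
      tail-cons-0 {τ} {m = m + m'} τs+2≡0 λ k → trans (rest k) (cong (λ xs → listSeq xs k) (blocks-++ m m'))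
    prepend-0 (m , 1 , 0 , _ , rest) =
      tail-cons-0 {τ} {m = m} τs+2≡0 λ k → trans (rest k) (listSeq-trailing-zero (blocks m) k)
    prepend-0 (m , 1 , suc m' , _ , rest) =
      ⊥-elim (no-second-gap j₀≤s τs+2≡0 (m≤m+n (3 + s) (ℓ + 0))
               (trans (rest (ℓ + 0)) (listSeq-++ (blocks m) _ 0))
               (trans (cong τ (sym (trans (cong (λ x → 3 + s + x) (+-suc ℓ 0)) (+-suc (3 + s) (ℓ + 0)))))
                      (trans (rest (ℓ + 1)) (listSeq-++ (blocks m) _ 1))))
      where
      ℓ : ℕ
      ℓ = length (blocks m)
    prepend-0 (_ , suc (suc _) , _ , s≤s () , _)

  -- Start reading at j₀ + 2, or one column later if j₀ + 2 lies inside a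
  -- (2,1)-block, i.e. if there is a kink at j₀ + 1.
  tail-start : TailShape τ (2 + j₀ + kink (suc j₀))
  tail-start with kink-cases (n≤1+n j₀)
  ... | inj₁ kink≡0 =
    subst (λ q → TailShape τ (2 + j₀ + q)) (sym kink≡0)
      (subst (TailShape τ) (sym (+-identityʳ (2 + j₀))) (tail-from N (m≤n+m N j₀) ≤-refl kink≡0))
  ... | inj₂ kink≡1 =
    subst (λ q → TailShape τ (2 + j₀ + q)) (sym kink≡1)
      (subst (TailShape τ) (cong (λ x → 2 + x) (+-comm 1 j₀))
        (tail-from N (m≤n+m N (suc j₀)) (n≤1+n j₀) (kink-isolated (n≤1+n j₀) kink≡1)))

  -- τ_{j₀+2} = 2 kink_{j₀+2} + kink_{j₀+1} is odd exactly when kink_{j₀+1} = 1.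
  start-parity : τ (2 + j₀) % 2 ≡ kink (suc j₀)
  start-parity = begin
    τ (2 + j₀) % 2                          ≡⟨ cong (_% 2) (reading (n≤1+n j₀)) ⟩
    (2 * kink (2 + j₀) + kink (suc j₀)) % 2 ≡⟨ cong (_% 2) (+-comm (2 * kink (2 + j₀)) _) ⟩
    (kink (suc j₀) + 2 * kink (2 + j₀)) % 2 ≡⟨ cong (λ x → (kink (suc j₀) + x) % 2) (*-comm 2 (kink (2 + j₀))) ⟩
    (kink (suc j₀) + kink (2 + j₀) * 2) % 2 ≡⟨ [m+kn]%n≡m%n (kink (suc j₀)) (kink (2 + j₀)) 2 ⟩
    kink (suc j₀) % 2                       ≡⟨ m<n⇒m%n≡m (s≤s (proj₁ (kink-unit (n≤1+n j₀)))) ⟩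
    kink (suc j₀)                           ∎
    where open ≡-Reasoning

below-next-power : ∀ N → N < 2 ^ suc ⌊log₂ N ⌋
below-next-power N with N <? 2 ^ suc ⌊log₂ N ⌋
... | yes N<2^l+1 = N<2^l+1
... | no  N≮2^l+1 = ⊥-elim (<-irrefl refl (subst (_≤ ⌊log₂ N ⌋) (⌊log₂[2^n]⌋≡n (suc ⌊log₂ N ⌋))
                                                  (⌊log₂⌋-mono-≤ (≮⇒≥ N≮2^l+1))))

log-bound : ∀ N → 3 * N < 2 ^ (3 + ⌊log₂ N ⌋)
log-bound N = begin-strict
  3 * N                        <⟨ *-monoʳ-< 3 (below-next-power N) ⟩
  3 * 2 ^ suc ⌊log₂ N ⌋        ≤⟨ *-monoˡ-≤ (2 ^ suc ⌊log₂ N ⌋) (n≤1+n 3) ⟩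
  4 * 2 ^ suc ⌊log₂ N ⌋        ≡⟨ quadruple (2 ^ ⌊log₂ N ⌋) ⟩
  2 ^ (3 + ⌊log₂ N ⌋)          ∎
  where
  open ≤-Reasoning
  quadruple : ∀ p → 4 * (2 * p) ≡ 2 * (2 * (2 * p))
  quadruple = solve-∀

π : ℕ → Config
π N = proj₁ (Stabilisation.stabilisation N)

tail-position : ℕ → ℕ
tail-position N = 8 + ⌊log₂ N ⌋ + π N (8 + ⌊log₂ N ⌋) % 2

tail-position-bound : ∀ N → tail-position N ≤ 9 * ⌊log₂ N ⌋ + 9
tail-position-bound N = begin
  8 + l + π N (8 + l) % 2 ≤⟨ +-monoʳ-≤ (8 + l) (s≤s⁻¹ (m%n<n (π N (8 + l)) 2)) ⟩
  8 + l + 1               ≡⟨ arith l ⟩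
  l + 9                   ≤⟨ +-monoˡ-≤ 9 (m≤n*m l 9) ⟩
  9 * l + 9               ∎
  where
  open ≤-Reasoning
  l : ℕ
  l = ⌊log₂ N ⌋
  arith : ∀ l → 8 + l + 1 ≡ l + 9
  arith = solve-∀

-- Main statement: every stable configuration reached from N grains has the
-- prescribed tail from tail-position N on (it is π(N) by uniqueness).
stable-tail : (N : ℕ) (τ : Config) → Reach 3 (init N) τ → Stable 3 τ → TailShape τ (tail-position N)
stable-tail N τ run stable with c , odo , least ← LeastAction.odometer 3 (s≤s (s≤s z≤n)) (init N) run =
  subst (TailShape τ) position tail-start
  where
  open StableShape N (3 + ⌊log₂ N ⌋) (log-bound N) odo stable least
  τ≡π : τ (2 + j₀) ≡ π N (2 + j₀)
  τ≡π = LeastAction.stable-unique 3 (s≤s (s≤s z≤n)) (init N) run stable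
          (proj₁ (proj₂ (Stabilisation.stabilisation N))) (proj₂ (proj₂ (Stabilisation.stabilisation N))) (2 + j₀)
  position : 2 + j₀ + kink (suc j₀) ≡ tail-position N
  position = cong (λ x → 2 + j₀ + x) (trans (sym start-parity) (cong (_% 2) τ≡π))

theorem1 : Σ (ℕ → ℕ) λ i →
    (Σ ℕ λ C → (N : ℕ) → i N ≤ C * ⌊log₂ N ⌋ + C) ×
    ((N : ℕ) (τ : Config) → Reach 3 (init N) τ → Stable 3 τ →
      Σ ℕ λ m → Σ ℕ λ e → Σ ℕ λ m' → e ≤ 1 ×
        ((k : ℕ) → τ (i N + k) ≡ listSeq (pattern21 m e m') k))
theorem1 = tail-position , (9 , tail-position-bound) , stable-tail
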